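{- Let $n$ be a nonnegative integer and let $a$ and $b$ be positive integers. Then \begin{align} (b)\,\widetilde{\text{ш}}\,(\{a\}^n) &=\sum_{i=0}^n (-1)^i\,(ai+b)*(\{a\}^{n-i}),\\ (b,b)\,\widetilde{\text{ш}}\,(\{a\}^n) &=\sum_{\substack{i,j\geq 0\\ 0\leq i+j\leq n}} (-1)^{i+j}\,(ai+b,aj+b)*(\{a\}^{n-i-j}). \end{align}
   Context: An index is a finite sequence of positive integers (possibly empty, written $\emptyset$); $(\{a\}^n)$ denotes the index $(a,\ldots,a)$ with $n$ entries. Let $\mathcal{I}$ be the $\mathbb{Q}$-vector space with basis all indices. The harmonic (stuffle) product $*$ is the $\mathbb{Q}$-bilinear product on $\mathcal{I}$ defined inductively by $\emptyset*\boldsymbol{k}=\boldsymbol{k}*\emptyset=\boldsymbol{k}$ and $(\boldsymbol{k},k)*(\boldsymbol{l},l)=(\boldsymbol{k}*(\boldsymbol{l},l),k)+((\boldsymbol{k},k)*\boldsymbol{l},l)+(\boldsymbol{k}*\boldsymbol{l},k+l)$ for indices $\boldsymbol{k},\boldsymbol{l}$ and positive integers $k,l$ (appending a last entry is extended linearly). The symbol $\widetilde{\text{ш}}$ denotes the (plain) shuffle of indices, extended bilinearly to $\mathcal{I}$: it is the sum of all interleavings of the two sequences preserving the internal order of each, e.g. $(a,b)\,\widetilde{\text{ш}}\,(c)=(c,a,b)+(a,c,b)+(a,b,c)$. -}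

module Defs where

open import Data.Nat as ℕ using (ℕ; zero; suc)
open import Data.List using (List; []; _∷_; _++_; map; reverse; replicate; concatMap; upTo)
open import Data.List.Properties using (≡-dec)
open import Data.Product using (_×_; _,_)
open import Data.Rational as ℚ using (ℚ; 0ℚ; 1ℚ; -_; _+_; _*_)
open import Relation.Binary.PropositionalEquality using (_≡_)
open import Relation.Nullary using (yes; no)

-- An index: finite sequence of (positive) integers; positivity is imposed
-- as hypotheses where needed.
Index : Set
Index = List ℕ

-- An element of the ℚ-vector space 𝓘 with basis the indices, represented
-- as a formal finite linear combination (list of coefficient/index pairs).
Lin : Set
Lin = List (ℚ × Index)

[_] : Index → Lin
[ k ] = (1ℚ , k) ∷ []

_•_ : ℚ → Lin → Lin
c • x = map (λ { (d , k) → (c * d , k) }) x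

coeff : Lin → Index → ℚ
coeff [] k = 0ℚ
coeff ((c , l) ∷ x) k with ≡-dec ℕ._≟_ l k
... | yes _ = c + coeff x k
... | no  _ = coeff x k

_≈_ : Lin → Lin → Set
x ≈ y = ∀ k → coeff x k ≡ coeff y k

infix 4 _≈_

-- harmonic product on reversed indices (head = last entry), following
-- (k,k)*(l,l) = (k*(l,l),k) + ((k,k)*l,l) + (k*l,k+l)
private
  consAll : ℕ → Lin → Lin
  consAll m = map (λ { (c , k) → (c , m ∷ k) })

  stR : Index → Index → Lin
  stR [] l = [ l ]
  stR (k ∷ ks) [] = [ k ∷ ks ]
  stR (k ∷ ks) (l ∷ ls) =
    consAll k (stR ks (l ∷ ls)) ++ consAll l (stR (k ∷ ks) ls)
      ++ consAll (k ℕ.+ l) (stR ks ls)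

_⊛_ : Index → Index → Lin
k ⊛ l = map (λ { (c , m) → (c , reverse m) }) (stR (reverse k) (reverse l))

shuffles : Index → Index → List Index
shuffles [] l = l ∷ []
shuffles (k ∷ ks) [] = (k ∷ ks) ∷ []
shuffles (k ∷ ks) (l ∷ ls) =
  map (k ∷_) (shuffles ks (l ∷ ls)) ++ map (l ∷_) (shuffles (k ∷ ks) ls)

_ш_ : Index → Index → Lin
k ш l = map (λ m → (1ℚ , m)) (shuffles k l)

sgn : ℕ → ℚ
sgn zero = 1ℚ
sgn (suc i) = - sgn i

∑[0‥_] : ℕ → (ℕ → Lin) → Lin
∑[0‥ n ] f = concatMap f (upTo (suc n))

{-# OPTIONS --safe #-}
module Submission where

open import Defs
open import Data.Nat using (ℕ; _+_; _*_; _∸_; _≥_)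
open import Data.List using (List; []; _∷_; replicate)
open import Data.Product using (_×_)

open import Algebra.Bundles using (CommutativeMonoid)
import Algebra.Properties.Ring as RingProperties
open import Data.Empty using (⊥-elim)
open import Data.List using (_++_; map; concat; concatMap; reverse; _∷ʳ_; drop; upTo)
import Data.List.Properties as List
open import Data.List.Relation.Binary.Permutation.Propositional as ↭ using (_↭_)
import Data.List.Relation.Binary.Permutation.Propositional.Properties as ↭
open import Data.Nat using (zero; suc)
import Data.Nat.Properties as ℕ
open import Data.Product using (_,_; map₂)
open import Data.Rational using (ℚ; 0ℚ; 1ℚ; -_) renaming (_+_ to _+ℚ_; _*_ to _*ℚ_)
import Data.Rational.Properties as ℚ
open import Function using (_∘_; id)
open import Relation.Binary.Bundles using (Setoid)
import Relation.Binary.Reasoning.Setoid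
open import Relation.Binary.PropositionalEquality
  using (_≡_; _≢_; refl; sym; trans; cong; cong₂; subst; subst₂)
open import Relation.Nullary using (Dec; yes; no)

-- Both identities follow by comparing last-letter recursions.  Shuffle and stuffle obey
--   (K,x) ш (L,y) = (K ш (L,y), x) + ((K,x) ш L, y),
--   (K,x) * (L,y) = (K * (L,y), x) + ((K,x) * L, y) + (K * L, x + y).
-- Put c_j = a j + b, so that c_j + a = c_(j+1), and f_j(m) = (K,c_j) * a^m.  Then
--   f_j(m+1) = (K * a^(m+1), c_j) + (f_j(m), a) + (K * a^m, c_(j+1)),
-- so in the alternating sum X(n) = ∑_(j+m=n) (-1)^j f_j(m) the last term of index j cancels the
-- first term of index j+1, leaving X(n+1) = (K * a^(n+1), b) + (X(n), a).  For K = ∅ this is the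
-- recursion of (b) ш a^n.  For K = (c_i), taking the alternating sum over i as well and using the
-- first identity gives the recursion of (b,b) ш a^n, namely Y(n+1) = ((b) ш a^(n+1), b) + (Y(n), a).

coeff-++ : ∀ x y k → coeff (x ++ y) k ≡ coeff x k +ℚ coeff y k
coeff-++ []            y k = sym (ℚ.+-identityˡ (coeff y k))
coeff-++ ((c , l) ∷ x) y k with List.≡-dec ℕ._≟_ l k
... | yes _ = trans (cong (c +ℚ_) (coeff-++ x y k)) (sym (ℚ.+-assoc c (coeff x k) (coeff y k)))
... | no  _ = coeff-++ x y k

coeff-• : ∀ s x k → coeff (s • x) k ≡ s *ℚ coeff x k
coeff-• s []            k = sym (ℚ.*-zeroʳ s)
coeff-• s ((c , l) ∷ x) k with List.≡-dec ℕ._≟_ l k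
... | yes _ = trans (cong (s *ℚ c +ℚ_) (coeff-• s x k)) (sym (ℚ.*-distribˡ-+ s c (coeff x k)))
... | no  _ = coeff-• s x k

-- A record around _≈_, so that both sides of an equation can be inferred from its proof.
record _≋_ (x y : Lin) : Set where
  constructor mk≋
  field coeff-≡ : x ≈ y
open _≋_

infix 4 _≋_

≋-setoid : Setoid _ _
≋-setoid = record
  { Carrier       = Lin
  ; _≈_           = _≋_
  ; isEquivalence = record
    { refl  = mk≋ λ _ → refl
    ; sym   = λ (mk≋ x≈y) → mk≋ λ k → sym (x≈y k)
    ; trans = λ (mk≋ x≈y) (mk≋ y≈z) → mk≋ λ k → trans (x≈y k) (y≈z k)
    }
  }

open RingProperties ℚ.+-*-ring using (-1*x≈-x)
open Setoid ≋-setoid using ()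
  renaming (refl to ≋-refl; sym to ≋-sym; trans to ≋-trans; reflexive to ≋-reflexive)
module ≋-Reasoning = Relation.Binary.Reasoning.Setoid ≋-setoid

++-cong : ∀ {x x′ y y′} → x ≋ x′ → y ≋ y′ → x ++ y ≋ x′ ++ y′
++-cong {x} {x′} {y} {y′} (mk≋ x≈x′) (mk≋ y≈y′) = mk≋ λ k →
  trans (coeff-++ x y k) (trans (cong₂ _+ℚ_ (x≈x′ k) (y≈y′ k)) (sym (coeff-++ x′ y′ k)))

++-congˡ : ∀ x {y y′} → y ≋ y′ → x ++ y ≋ x ++ y′
++-congˡ x = ++-cong {x} ≋-refl

++-congʳ : ∀ {x x′} y → x ≋ x′ → x ++ y ≋ x′ ++ y
++-congʳ y x≋x′ = ++-cong x≋x′ (≋-refl {y})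

++-comm : ∀ x y → x ++ y ≋ y ++ x
++-comm x y = mk≋ λ k →
  trans (coeff-++ x y k) (trans (ℚ.+-comm (coeff x k) (coeff y k)) (sym (coeff-++ y x k)))

++-commutativeMonoid : CommutativeMonoid _ _
++-commutativeMonoid = record
  { Carrier             = Lin
  ; _≈_                 = _≋_
  ; _∙_                 = _++_
  ; ε                   = []
  ; isCommutativeMonoid = record
    { isMonoid = record
      { isSemigroup = record
        { isMagma = record { isEquivalence = Setoid.isEquivalence ≋-setoid ; ∙-cong = ++-cong }
        ; assoc   = λ x y z → ≋-reflexive (List.++-assoc x y z)
        }
      ; identity = (λ _ → ≋-refl) , λ x → ≋-reflexive (List.++-identityʳ x)
      }
    ; comm = ++-comm
    }
  }

open import Algebra.Solver.CommutativeMonoid ++-commutativeMonoid using (solve; _⊕_; _⊜_)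
open import Algebra.Solver.CommutativeMonoid (↭.++-commutativeMonoid {A = Index}) using ()
  renaming (solve to ↭-solve; _⊕_ to _⊕ᵖ_; _⊜_ to _⊜ᵖ_)

•-cong : ∀ s {x y} → x ≋ y → s • x ≋ s • y
•-cong s {x} {y} (mk≋ x≈y) = mk≋ λ k →
  trans (coeff-• s x k) (trans (cong (s *ℚ_) (x≈y k)) (sym (coeff-• s y k)))

•-++ : ∀ s x y → s • (x ++ y) ≡ s • x ++ s • y
•-++ s = List.map-++ _

•-• : ∀ s t x → s • (t • x) ≡ (s *ℚ t) • x
•-• s t x = trans (sym (List.map-∘ x))
  (List.map-cong (λ (c , l) → cong (_, l) (sym (ℚ.*-assoc s t c))) x)

1•-identity : ∀ x → 1ℚ • x ≡ x
1•-identity x = trans (List.map-cong (λ (c , l) → cong (_, l) (ℚ.*-identityˡ c)) x) (List.map-id x)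

-1•-inverse : ∀ x → (- 1ℚ) • x ++ x ≋ []
-1•-inverse x = mk≋ λ k → trans (coeff-++ ((- 1ℚ) • x) x k)
  (trans (cong (_+ℚ coeff x k) (trans (coeff-• (- 1ℚ) x k) (-1*x≈-x (coeff x k))))
         (ℚ.+-inverseˡ (coeff x k)))

mapIndex : (Index → Index) → Lin → Lin
mapIndex f = map (map₂ f)

mapIndex-• : ∀ f s x → mapIndex f (s • x) ≡ s • mapIndex f x
mapIndex-• f s x = trans (sym (List.map-∘ x)) (List.map-∘ x)

module _ (f r : Index → Index) (r∘f : ∀ l → r (f l) ≡ l) where

  coeff-mapIndex : ∀ x l → coeff (mapIndex f x) (f l) ≡ coeff x l
  coeff-mapIndex []             l = refl
  coeff-mapIndex ((c , l′) ∷ x) l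
    with List.≡-dec ℕ._≟_ (f l′) (f l) | List.≡-dec ℕ._≟_ l′ l
  ... | yes _      | yes _     = cong (c +ℚ_) (coeff-mapIndex x l)
  ... | yes fl′≡fl | no  l′≢l  = ⊥-elim (l′≢l (trans (sym (r∘f l′)) (trans (cong r fl′≡fl) (r∘f l))))
  ... | no  fl′≢fl | yes l′≡l  = ⊥-elim (fl′≢fl (cong f l′≡l))
  ... | no  _      | no  _     = coeff-mapIndex x l

  coeff-mapIndex-∉ : ∀ x k → (∀ l → f l ≢ k) → coeff (mapIndex f x) k ≡ 0ℚ
  coeff-mapIndex-∉ []            k k∉f = refl
  coeff-mapIndex-∉ ((c , l) ∷ x) k k∉f with List.≡-dec ℕ._≟_ (f l) k
  ... | yes fl≡k = ⊥-elim (k∉f l fl≡k)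
  ... | no  _    = coeff-mapIndex-∉ x k k∉f

  mapIndex-cong : ∀ {x y} → x ≋ y → mapIndex f x ≋ mapIndex f y
  mapIndex-cong {x} {y} (mk≋ x≈y) = mk≋ λ k → coeff-at k (List.≡-dec ℕ._≟_ (f (r k)) k)
    where
    coeff-at : ∀ k → Dec (f (r k) ≡ k) → coeff (mapIndex f x) k ≡ coeff (mapIndex f y) k
    coeff-at k (yes f∘r≡k) = subst (λ k → coeff (mapIndex f x) k ≡ coeff (mapIndex f y) k) f∘r≡k
      (trans (coeff-mapIndex x (r k)) (trans (x≈y (r k)) (sym (coeff-mapIndex y (r k)))))
    coeff-at k (no f∘r≢k) = trans (coeff-mapIndex-∉ x k k∉f) (sym (coeff-mapIndex-∉ y k k∉f))
      where
      k∉f : ∀ l → f l ≢ k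
      k∉f l fl≡k = f∘r≢k (trans (cong (f ∘ r) (sym fl≡k)) (trans (cong f (r∘f l)) fl≡k))

snoc : ℕ → Lin → Lin
snoc m = mapIndex (_∷ʳ m)

snoc-cong : ∀ m {x y} → x ≋ y → snoc m x ≋ snoc m y
snoc-cong m = mapIndex-cong (_∷ʳ m) (reverse ∘ drop 1 ∘ reverse) λ l →
  trans (cong (reverse ∘ drop 1) (List.reverse-++ l (m ∷ []))) (List.reverse-involutive l)

snoc-++ : ∀ m x y → snoc m (x ++ y) ≡ snoc m x ++ snoc m y
snoc-++ m = List.map-++ _

↭⇒≋ : ∀ {x y} → x ↭ y → x ≋ y
↭⇒≋ ↭.refl          = ≋-refl
↭⇒≋ (↭.prep p x↭y)  = ++-cong {p ∷ []} ≋-refl (↭⇒≋ x↭y)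
↭⇒≋ {y = _ ∷ _ ∷ y} (↭.swap p q x↭y) = ≋-trans
  (++-cong {p ∷ []} ≋-refl (++-cong {q ∷ []} ≋-refl (↭⇒≋ x↭y)))
  (solve 3 (λ p q y → p ⊕ (q ⊕ y) ⊜ q ⊕ (p ⊕ y)) ≋-refl (p ∷ []) (q ∷ []) y)
↭⇒≋ (↭.trans x↭y y↭z) = ≋-trans (↭⇒≋ x↭y) (↭⇒≋ y↭z)

[]-⊛ : ∀ L → [] ⊛ L ≡ [ L ]
[]-⊛ L = cong [_] (List.reverse-involutive L)

⊛-[] : ∀ K → K ⊛ [] ≡ [ K ]
⊛-[] K with reverse K in eq
... | []    = cong [_] (trans (cong reverse (sym eq)) (List.reverse-involutive K))
... | _ ∷ _ = cong [_] (trans (cong reverse (sym eq)) (List.reverse-involutive K))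

reverse-cons : ∀ m x → mapIndex reverse (mapIndex (m ∷_) x) ≡ snoc m (mapIndex reverse x)
reverse-cons m x = trans (sym (List.map-∘ x))
  (trans (List.map-cong (λ (c , l) → cong (c ,_) (List.unfold-reverse m l)) x) (List.map-∘ x))

-- _⊛_ is a private recursion on reversed indices; abstracting the reversed arguments, and the
-- three smaller products along with them, lets that recursion unfold one step.
⊛-∷ʳ : ∀ K k L l → (K ∷ʳ k) ⊛ (L ∷ʳ l)
  ≡ snoc k (K ⊛ (L ∷ʳ l)) ++ snoc l ((K ∷ʳ k) ⊛ L) ++ snoc (k + l) (K ⊛ L)
⊛-∷ʳ K k L l
  with reverse (K ∷ʳ k) | List.reverse-++ K (k ∷ []) | reverse (L ∷ʳ l) | List.reverse-++ L (l ∷ [])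
     | K ⊛ (L ∷ʳ l) in e₁ | (K ∷ʳ k) ⊛ L in e₂ | K ⊛ L in e₃
... | _ | refl | _ | refl | _ | _ | _ = unfold e₁ e₂ e₃
  where
  unfold : ∀ {x₁ x₂ x₃ w₁ w₂ w₃} →
    mapIndex reverse x₁ ≡ w₁ → mapIndex reverse x₂ ≡ w₂ → mapIndex reverse x₃ ≡ w₃ →
    mapIndex reverse (mapIndex (k ∷_) x₁ ++ mapIndex (l ∷_) x₂ ++ mapIndex (k + l ∷_) x₃)
      ≡ snoc k w₁ ++ snoc l w₂ ++ snoc (k + l) w₃
  unfold {x₁} {x₂} {x₃} refl refl refl =
    trans (List.map-++ _ (mapIndex (k ∷_) x₁) _) (cong₂ _++_ (reverse-cons k x₁)
      (trans (List.map-++ _ (mapIndex (l ∷_) x₂) _)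
             (cong₂ _++_ (reverse-cons l x₂) (reverse-cons (k + l) x₃))))

shuffles-[]ʳ : ∀ xs → shuffles xs [] ≡ xs ∷ []
shuffles-[]ʳ []      = refl
shuffles-[]ʳ (_ ∷ _) = refl

map-∷-∷ʳ : ∀ p x (zss : List Index) → map (p ∷_) (map (_∷ʳ x) zss) ≡ map (_∷ʳ x) (map (p ∷_) zss)
map-∷-∷ʳ p x zss = trans (sym (List.map-∘ zss)) (List.map-∘ zss)

shuffles-∷ʳ : ∀ xs x ys y → shuffles (xs ∷ʳ x) (ys ∷ʳ y)
  ↭ map (_∷ʳ x) (shuffles xs (ys ∷ʳ y)) ++ map (_∷ʳ y) (shuffles (xs ∷ʳ x) ys)
shuffles-∷ʳ [] x [] y = ↭.swap _ _ ↭.refl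
shuffles-∷ʳ [] x (q ∷ ys) y = ↭.trans
  (↭.prep _ (↭.map⁺ (q ∷_) (shuffles-∷ʳ [] x ys y)))
  (↭.swap _ _ (↭.↭-reflexive (map-∷-∷ʳ q y (shuffles (x ∷ []) ys))))
shuffles-∷ʳ (p ∷ xs) x [] y = begin
    map (p ∷_) (shuffles (xs ∷ʳ x) (y ∷ [])) ++ yx ∷ []
  ↭⟨ ↭.++⁺ʳ _ (↭.map⁺ (p ∷_) (shuffles-∷ʳ xs x [] y)) ⟩
    map (p ∷_) (map (_∷ʳ x) S ++ map (_∷ʳ y) (shuffles (xs ∷ʳ x) [])) ++ yx ∷ []
  ≡⟨ cong (λ zss → map (p ∷_) (map (_∷ʳ x) S ++ map (_∷ʳ y) zss) ++ yx ∷ []) (shuffles-[]ʳ (xs ∷ʳ x)) ⟩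
    map (p ∷_) (map (_∷ʳ x) S ++ (xs ∷ʳ x ∷ʳ y) ∷ []) ++ yx ∷ []
  ≡⟨ cong (_++ yx ∷ [])
       (trans (List.map-++ (p ∷_) (map (_∷ʳ x) S) _) (cong (_++ xy ∷ []) (map-∷-∷ʳ p x S))) ⟩
    (map (_∷ʳ x) (map (p ∷_) S) ++ xy ∷ []) ++ yx ∷ []
  ↭⟨ ↭-solve 3 (λ s u v → (s ⊕ᵖ u) ⊕ᵖ v ⊜ᵖ (s ⊕ᵖ v) ⊕ᵖ u) ↭.refl
       (map (_∷ʳ x) (map (p ∷_) S)) (xy ∷ []) (yx ∷ []) ⟩
    (map (_∷ʳ x) (map (p ∷_) S) ++ yx ∷ []) ++ xy ∷ []
  ≡⟨ cong (_++ xy ∷ []) (List.map-++ (_∷ʳ x) (map (p ∷_) S) _) ⟨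
    map (_∷ʳ x) (shuffles (p ∷ xs) (y ∷ [])) ++ map (_∷ʳ y) (shuffles (p ∷ xs ∷ʳ x) []) ∎
  where
  open ↭.PermutationReasoning
  S = shuffles xs (y ∷ [])
  xy = p ∷ xs ∷ʳ x ∷ʳ y
  yx = y ∷ p ∷ xs ∷ʳ x
shuffles-∷ʳ (p ∷ xs) x (q ∷ ys) y = begin
    map (p ∷_) (shuffles (xs ∷ʳ x) (q ∷ ys ∷ʳ y)) ++ map (q ∷_) (shuffles (p ∷ xs ∷ʳ x) (ys ∷ʳ y))
  ↭⟨ ↭.++⁺ (↭.map⁺ (p ∷_) (shuffles-∷ʳ xs x (q ∷ ys) y)) (↭.map⁺ (q ∷_) (shuffles-∷ʳ (p ∷ xs) x ys y)) ⟩
    map (p ∷_) (map (_∷ʳ x) A ++ map (_∷ʳ y) B) ++ map (q ∷_) (map (_∷ʳ x) C ++ map (_∷ʳ y) D)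
  ≡⟨ cong₂ _++_ (push p A B) (push q C D) ⟩
    (map (_∷ʳ x) (map (p ∷_) A) ++ map (_∷ʳ y) (map (p ∷_) B))
      ++ (map (_∷ʳ x) (map (q ∷_) C) ++ map (_∷ʳ y) (map (q ∷_) D))
  ↭⟨ ↭-solve 4 (λ a b c d → (a ⊕ᵖ b) ⊕ᵖ (c ⊕ᵖ d) ⊜ᵖ (a ⊕ᵖ c) ⊕ᵖ (b ⊕ᵖ d)) ↭.refl
       (map (_∷ʳ x) (map (p ∷_) A)) (map (_∷ʳ y) (map (p ∷_) B))
       (map (_∷ʳ x) (map (q ∷_) C)) (map (_∷ʳ y) (map (q ∷_) D)) ⟩
    (map (_∷ʳ x) (map (p ∷_) A) ++ map (_∷ʳ x) (map (q ∷_) C))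
      ++ (map (_∷ʳ y) (map (p ∷_) B) ++ map (_∷ʳ y) (map (q ∷_) D))
  ≡⟨ cong₂ _++_ (List.map-++ (_∷ʳ x) (map (p ∷_) A) _) (List.map-++ (_∷ʳ y) (map (p ∷_) B) _) ⟨
    map (_∷ʳ x) (shuffles (p ∷ xs) (q ∷ ys ∷ʳ y)) ++ map (_∷ʳ y) (shuffles (p ∷ xs ∷ʳ x) (q ∷ ys)) ∎
  where
  open ↭.PermutationReasoning
  A = shuffles xs (q ∷ ys ∷ʳ y)
  B = shuffles (xs ∷ʳ x) (q ∷ ys)
  C = shuffles (p ∷ xs) (ys ∷ʳ y)
  D = shuffles (p ∷ xs ∷ʳ x) ys
  push : ∀ r U V → map (r ∷_) (map (_∷ʳ x) U ++ map (_∷ʳ y) V)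
                 ≡ map (_∷ʳ x) (map (r ∷_) U) ++ map (_∷ʳ y) (map (r ∷_) V)
  push r U V = trans (List.map-++ (r ∷_) (map (_∷ʳ x) U) _)
    (cong₂ _++_ (map-∷-∷ʳ r x U) (map-∷-∷ʳ r y V))

ш-∷ʳ : ∀ xs x ys y → (xs ∷ʳ x) ш (ys ∷ʳ y) ≋ snoc x (xs ш (ys ∷ʳ y)) ++ snoc y ((xs ∷ʳ x) ш ys)
ш-∷ʳ xs x ys y = ≋-trans (↭⇒≋ (↭.map⁺ (1ℚ ,_) (shuffles-∷ʳ xs x ys y)))
  (≋-reflexive (trans (List.map-++ (1ℚ ,_) (map (_∷ʳ x) S₁) _)
                      (cong₂ _++_ (basis-∷ʳ x S₁) (basis-∷ʳ y S₂))))
  where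
  basis-∷ʳ : ∀ z zss → map (1ℚ ,_) (map (_∷ʳ z) zss) ≡ snoc z (map (1ℚ ,_) zss)
  basis-∷ʳ z zss = trans (sym (List.map-∘ zss)) (List.map-∘ zss)
  S₁ = shuffles xs (ys ∷ʳ y)
  S₂ = shuffles (xs ∷ʳ x) ys

∑-suc : ∀ n f → ∑[0‥ suc n ] f ≡ f 0 ++ ∑[0‥ n ] (f ∘ suc)
∑-suc n f = cong (λ xs → f 0 ++ concat xs)
  (trans (List.map-applyUpTo suc f (suc n)) (sym (List.map-applyUpTo id (f ∘ suc) (suc n))))

∑-cong : ∀ n {f g} → (∀ i → f i ≋ g i) → ∑[0‥ n ] f ≋ ∑[0‥ n ] g
∑-cong n {f} {g} f≋g = concatMap-cong (upTo (suc n))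
  where
  concatMap-cong : ∀ is → concatMap f is ≋ concatMap g is
  concatMap-cong []       = ≋-refl
  concatMap-cong (i ∷ is) = ++-cong (f≋g i) (concatMap-cong is)

map-∑ : ∀ n h f → map h (∑[0‥ n ] f) ≡ ∑[0‥ n ] (map h ∘ f)
map-∑ n h f = List.map-concatMap h f (upTo (suc n))

alternatingSum : (ℕ → ℕ → Lin) → ℕ → Lin
alternatingSum f zero    = f 0 0
alternatingSum f (suc n) = f 0 (suc n) ++ (- 1ℚ) • alternatingSum (f ∘ suc) n

sgn-suc-• : ∀ i x → sgn (suc i) • x ≡ (- 1ℚ) • (sgn i • x)
sgn-suc-• i x = trans (cong (_• x) (sym (-1*x≈-x (sgn i)))) (sym (•-• (- 1ℚ) (sgn i) x))

sgn-+ : ∀ i j → sgn (i + j) ≡ sgn i *ℚ sgn j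
sgn-+ zero    j = sym (ℚ.*-identityˡ (sgn j))
sgn-+ (suc i) j = trans (cong -_ (sgn-+ i j)) (ℚ.neg-distribˡ-* (sgn i) (sgn j))

∑-alternatingSum : ∀ n f → ∑[0‥ n ] (λ i → sgn i • f i (n ∸ i)) ≋ alternatingSum f n
∑-alternatingSum zero    f = ≋-reflexive (trans (List.++-identityʳ _) (1•-identity (f 0 0)))
∑-alternatingSum (suc n) f = begin
  ∑[0‥ suc n ] (λ i → sgn i • f i (suc n ∸ i))
    ≡⟨ ∑-suc n (λ i → sgn i • f i (suc n ∸ i)) ⟩
  1ℚ • f 0 (suc n) ++ ∑[0‥ n ] (λ i → sgn (suc i) • f (suc i) (n ∸ i))
    ≈⟨ ++-cong (≋-reflexive (1•-identity (f 0 (suc n))))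
               (∑-cong n λ i → ≋-reflexive (sgn-suc-• i (f (suc i) (n ∸ i)))) ⟩
  f 0 (suc n) ++ ∑[0‥ n ] (λ i → (- 1ℚ) • (sgn i • f (suc i) (n ∸ i)))
    ≡⟨ cong (f 0 (suc n) ++_) (map-∑ n _ _) ⟨
  f 0 (suc n) ++ (- 1ℚ) • ∑[0‥ n ] (λ i → sgn i • f (suc i) (n ∸ i))
    ≈⟨ ++-congˡ (f 0 (suc n)) (•-cong (- 1ℚ) (∑-alternatingSum n (f ∘ suc))) ⟩
  alternatingSum f (suc n) ∎
  where open ≋-Reasoning

∑∑-alternatingSum : ∀ n (f : ℕ → ℕ → ℕ → Lin) →
  ∑[0‥ n ] (λ i → ∑[0‥ n ∸ i ] (λ j → sgn (i + j) • f i j (n ∸ i ∸ j)))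
    ≋ alternatingSum (λ i → alternatingSum (f i)) n
∑∑-alternatingSum n f = begin
  ∑[0‥ n ] (λ i → ∑[0‥ n ∸ i ] (λ j → sgn (i + j) • f i j (n ∸ i ∸ j)))
    ≈⟨ ∑-cong n (λ i → ∑-cong (n ∸ i) λ j → ≋-reflexive (sgn-+-• i j)) ⟩
  ∑[0‥ n ] (λ i → ∑[0‥ n ∸ i ] (λ j → sgn i • (sgn j • f i j (n ∸ i ∸ j))))
    ≈⟨ ∑-cong n (λ i → ≋-reflexive (sym (map-∑ (n ∸ i) _ (λ j → sgn j • f i j (n ∸ i ∸ j))))) ⟩
  ∑[0‥ n ] (λ i → sgn i • ∑[0‥ n ∸ i ] (λ j → sgn j • f i j (n ∸ i ∸ j)))
    ≈⟨ ∑-cong n (λ i → •-cong (sgn i) (∑-alternatingSum (n ∸ i) (f i))) ⟩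
  ∑[0‥ n ] (λ i → sgn i • alternatingSum (f i) (n ∸ i))
    ≈⟨ ∑-alternatingSum n (λ i → alternatingSum (f i)) ⟩
  alternatingSum (λ i → alternatingSum (f i)) n ∎
  where
  open ≋-Reasoning
  sgn-+-• : ∀ i j → sgn (i + j) • f i j (n ∸ i ∸ j) ≡ sgn i • (sgn j • f i j (n ∸ i ∸ j))
  sgn-+-• i j = trans (cong (_• f i j (n ∸ i ∸ j)) (sgn-+ i j)) (sym (•-• (sgn i) (sgn j) _))

snoc-alternatingSum : ∀ m f n → snoc m (alternatingSum f n) ≡ alternatingSum (λ i k → snoc m (f i k)) n
snoc-alternatingSum m f zero    = refl
snoc-alternatingSum m f (suc n) = trans (snoc-++ m (f 0 (suc n)) _)
  (cong (snoc m (f 0 (suc n)) ++_)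
    (trans (mapIndex-• _ (- 1ℚ) _) (cong ((- 1ℚ) •_) (snoc-alternatingSum m (f ∘ suc) n))))

alternatingSum-[] : ∀ n → alternatingSum (λ _ _ → []) n ≡ []
alternatingSum-[] zero    = refl
alternatingSum-[] (suc n) = cong ((- 1ℚ) •_) (alternatingSum-[] n)

module _ (a : ℕ) where

  alternatingSum-step : ∀ {f g e : ℕ → ℕ → Lin} →
    (∀ i k → f i (suc k) ≋ g i (suc k) ++ snoc a (f i k) ++ e i k) → (∀ i → f i 0 ≋ g i 0) →
    ∀ m → alternatingSum f (suc m)
            ≋ alternatingSum g (suc m) ++ snoc a (alternatingSum f m) ++ alternatingSum e m
  alternatingSum-step {f} {g} {e} step base zero = begin
    f 0 1 ++ (- 1ℚ) • f 1 0
      ≈⟨ ++-cong (step 0 0) (•-cong (- 1ℚ) (base 1)) ⟩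
    (g 0 1 ++ snoc a (f 0 0) ++ e 0 0) ++ (- 1ℚ) • g 1 0
      ≈⟨ solve 4 (λ x y z w → (x ⊕ (y ⊕ z)) ⊕ w ⊜ (x ⊕ w) ⊕ (y ⊕ z)) ≋-refl
           (g 0 1) (snoc a (f 0 0)) (e 0 0) ((- 1ℚ) • g 1 0) ⟩
    (g 0 1 ++ (- 1ℚ) • g 1 0) ++ snoc a (f 0 0) ++ e 0 0 ∎
    where open ≋-Reasoning
  alternatingSum-step {f} {g} {e} step base (suc m) = begin
    f 0 (suc (suc m)) ++ (- 1ℚ) • alternatingSum (f ∘ suc) (suc m)
      ≈⟨ ++-cong (step 0 (suc m)) (•-cong (- 1ℚ)
           (alternatingSum-step {f ∘ suc} {g ∘ suc} {e ∘ suc} (step ∘ suc) (base ∘ suc) m)) ⟩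
    (g₀ ++ snoc a f₀ ++ e₀) ++ (- 1ℚ) • (G ++ snoc a F ++ E)
      ≡⟨ cong ((g₀ ++ snoc a f₀ ++ e₀) ++_)
           (trans (•-++ (- 1ℚ) G _) (cong ((- 1ℚ) • G ++_) (•-++ (- 1ℚ) (snoc a F) E))) ⟩
    (g₀ ++ snoc a f₀ ++ e₀) ++ ((- 1ℚ) • G ++ (- 1ℚ) • snoc a F ++ (- 1ℚ) • E)
      ≈⟨ solve 6 (λ x₁ y₁ z₁ x₂ y₂ z₂ →
           (x₁ ⊕ (y₁ ⊕ z₁)) ⊕ (x₂ ⊕ (y₂ ⊕ z₂)) ⊜ (x₁ ⊕ x₂) ⊕ ((y₁ ⊕ y₂) ⊕ (z₁ ⊕ z₂))) ≋-refl
           g₀ (snoc a f₀) e₀ ((- 1ℚ) • G) ((- 1ℚ) • snoc a F) ((- 1ℚ) • E) ⟩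
    (g₀ ++ (- 1ℚ) • G) ++ (snoc a f₀ ++ (- 1ℚ) • snoc a F) ++ (e₀ ++ (- 1ℚ) • E)
      ≡⟨ cong (λ y → (g₀ ++ (- 1ℚ) • G) ++ y ++ (e₀ ++ (- 1ℚ) • E))
           (trans (snoc-++ a f₀ _) (cong (snoc a f₀ ++_) (mapIndex-• _ (- 1ℚ) F))) ⟨
    alternatingSum g (suc (suc m)) ++ snoc a (alternatingSum f (suc m)) ++ alternatingSum e (suc m) ∎
    where
    open ≋-Reasoning
    g₀ = g 0 (suc (suc m))
    f₀ = f 0 (suc m)
    e₀ = e 0 (suc m)
    G = alternatingSum (g ∘ suc) (suc m)
    F = alternatingSum (f ∘ suc) m
    E = alternatingSum (e ∘ suc) m

  alternatingSum-telescope : ∀ {f g : ℕ → ℕ → Lin} →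
    (∀ i k → f i (suc k) ≋ g i (suc k) ++ snoc a (f i k) ++ g (suc i) k) → (∀ i → f i 0 ≋ g i 0) →
    ∀ m → alternatingSum f (suc m) ≋ g 0 (suc m) ++ snoc a (alternatingSum f m)
  alternatingSum-telescope {f} {g} step base m = begin
    alternatingSum f (suc m)
      ≈⟨ alternatingSum-step {f} {g} {g ∘ suc} step base m ⟩
    (g 0 (suc m) ++ (- 1ℚ) • G) ++ snoc a F ++ G
      ≈⟨ solve 4 (λ x y z w → (x ⊕ y) ⊕ (z ⊕ w) ⊜ x ⊕ (z ⊕ (y ⊕ w))) ≋-refl
           (g 0 (suc m)) ((- 1ℚ) • G) (snoc a F) G ⟩
    g 0 (suc m) ++ snoc a F ++ ((- 1ℚ) • G ++ G)
      ≈⟨ ++-congˡ (g 0 (suc m)) (++-congˡ (snoc a F) (-1•-inverse G)) ⟩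
    g 0 (suc m) ++ snoc a F ++ []
      ≡⟨ cong (g 0 (suc m) ++_) (List.++-identityʳ _) ⟩
    g 0 (suc m) ++ snoc a F ∎
    where
    open ≋-Reasoning
    F = alternatingSum f m
    G = alternatingSum (g ∘ suc) m

  alternatingSum-step′ : ∀ {f g : ℕ → ℕ → Lin} →
    (∀ i k → f i (suc k) ≋ g i (suc k) ++ snoc a (f i k)) → (∀ i → f i 0 ≋ g i 0) →
    ∀ m → alternatingSum f (suc m) ≋ alternatingSum g (suc m) ++ snoc a (alternatingSum f m)
  alternatingSum-step′ {f} {g} step base m = begin
    alternatingSum f (suc m)
      ≈⟨ alternatingSum-step {f} {g} {λ _ _ → []} step′ base m ⟩
    alternatingSum g (suc m) ++ snoc a F ++ alternatingSum (λ _ _ → []) m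
      ≡⟨ cong (λ z → alternatingSum g (suc m) ++ snoc a F ++ z) (alternatingSum-[] m) ⟩
    alternatingSum g (suc m) ++ snoc a F ++ []
      ≡⟨ cong (alternatingSum g (suc m) ++_) (List.++-identityʳ _) ⟩
    alternatingSum g (suc m) ++ snoc a F ∎
    where
    open ≋-Reasoning
    F = alternatingSum f m
    step′ : ∀ i k → f i (suc k) ≋ g i (suc k) ++ snoc a (f i k) ++ []
    step′ i k = ≋-trans (step i k) (≋-reflexive (cong (g i (suc k) ++_) (sym (List.++-identityʳ _))))

  snoc-recursion-unique : ∀ {X Y G : ℕ → Lin} →
    (∀ m → X (suc m) ≋ G (suc m) ++ snoc a (X m)) → (∀ m → Y (suc m) ≋ G (suc m) ++ snoc a (Y m)) →
    X 0 ≋ Y 0 → ∀ m → X m ≋ Y m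
  snoc-recursion-unique                 X-suc Y-suc X₀≋Y₀ zero    = X₀≋Y₀
  snoc-recursion-unique {X} {Y} {G} X-suc Y-suc X₀≋Y₀ (suc m) = ≋-trans (X-suc m)
    (≋-trans (++-congˡ (G (suc m)) (snoc-cong a (snoc-recursion-unique {X} {Y} {G} X-suc Y-suc X₀≋Y₀ m)))
             (≋-sym (Y-suc m)))

replicate-∷ʳ : ∀ m (a : ℕ) → replicate (suc m) a ≡ replicate m a ∷ʳ a
replicate-∷ʳ zero    a = refl
replicate-∷ʳ (suc m) a = cong (a ∷_) (replicate-∷ʳ m a)

module Progression (a : ℕ) (c : ℕ → ℕ) (c-suc : ∀ i → c (suc i) ≡ c i + a) where

  stuffleFamily : Index → ℕ → ℕ → Lin
  stuffleFamily K j m = (K ∷ʳ c j) ⊛ replicate m a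

  alternatingSum-stuffleFamily : ∀ K m → alternatingSum (stuffleFamily K) (suc m)
    ≋ snoc (c 0) (K ⊛ replicate (suc m) a) ++ snoc a (alternatingSum (stuffleFamily K) m)
  alternatingSum-stuffleFamily K = alternatingSum-telescope a {stuffleFamily K} {h} step base
    where
    h : ℕ → ℕ → Lin
    h j m = snoc (c j) (K ⊛ replicate m a)
    step : ∀ j k → stuffleFamily K j (suc k) ≋ h j (suc k) ++ snoc a (stuffleFamily K j k) ++ h (suc j) k
    step j k = subst₂
      (λ L d → (K ∷ʳ c j) ⊛ L
                 ≋ snoc (c j) (K ⊛ L) ++ snoc a (stuffleFamily K j k) ++ snoc d (K ⊛ replicate k a))
      (sym (replicate-∷ʳ k a)) (sym (c-suc j)) (≋-reflexive (⊛-∷ʳ K (c j) (replicate k a) a))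
    base : ∀ j → stuffleFamily K j 0 ≋ h j 0
    base j = ≋-reflexive (trans (⊛-[] (K ∷ʳ c j)) (cong (snoc (c j)) (sym (⊛-[] K))))

  ш-replicate-suc : ∀ K m → (K ∷ʳ c 0) ш replicate (suc m) a
    ≋ snoc (c 0) (K ш replicate (suc m) a) ++ snoc a ((K ∷ʳ c 0) ш replicate m a)
  ш-replicate-suc K m =
    subst (λ L → (K ∷ʳ c 0) ш L ≋ snoc (c 0) (K ш L) ++ snoc a ((K ∷ʳ c 0) ш replicate m a))
    (sym (replicate-∷ʳ m a)) (ш-∷ʳ K (c 0) (replicate m a) a)

  alternatingSum≋single-ш : ∀ m → alternatingSum (stuffleFamily []) m ≋ (c 0 ∷ []) ш replicate m a
  alternatingSum≋single-ш = snoc-recursion-unique a {G = λ m → [ replicate m a ∷ʳ c 0 ]}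
    (λ m → ≋-trans (alternatingSum-stuffleFamily [] m)
                   (++-congʳ _ (≋-reflexive (cong (snoc (c 0)) ([]-⊛ (replicate (suc m) a))))))
    (ш-replicate-suc [])
    ≋-refl

  alternatingSum²≋double-ш : ∀ m → alternatingSum (λ i → alternatingSum (stuffleFamily (c i ∷ []))) m
    ≋ (c 0 ∷ c 0 ∷ []) ш replicate m a
  alternatingSum²≋double-ш = snoc-recursion-unique a {G = λ m → snoc (c 0) ((c 0 ∷ []) ш replicate m a)}
    step (ш-replicate-suc (c 0 ∷ [])) ≋-refl
    where
    F : ℕ → ℕ → Lin
    F i = alternatingSum (stuffleFamily (c i ∷ []))
    step : ∀ m → alternatingSum F (suc m)
      ≋ snoc (c 0) ((c 0 ∷ []) ш replicate (suc m) a) ++ snoc a (alternatingSum F m)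
    step m = ≋-trans
      (alternatingSum-step′ a {F} {λ i k → snoc (c 0) (stuffleFamily [] i k)}
         (λ i → alternatingSum-stuffleFamily (c i ∷ [])) (λ i → ≋-refl) m)
      (++-congʳ _ (≋-trans (≋-reflexive (sym (snoc-alternatingSum (c 0) (stuffleFamily []) (suc m))))
                           (snoc-cong (c 0) (alternatingSum≋single-ш (suc m)))))

lemma2p4 : (n a b : ℕ) → a ≥ 1 → b ≥ 1 →
    ((b ∷ []) ш replicate n a
      ≈ ∑[0‥ n ] (λ i → sgn i • ((a * i + b ∷ []) ⊛ replicate (n ∸ i) a)))
    × ((b ∷ b ∷ []) ш replicate n a
      ≈ ∑[0‥ n ] (λ i → ∑[0‥ n ∸ i ] (λ j →
          sgn (i + j) • ((a * i + b ∷ a * j + b ∷ []) ⊛ replicate (n ∸ i ∸ j) a))))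
lemma2p4 n a b _ _ = coeff-≡ (≋-sym identity₁) , coeff-≡ (≋-sym identity₂)
  where
  c-suc : ∀ i → a * suc i + b ≡ a * i + b + a
  c-suc i = trans (cong (_+ b) (ℕ.*-suc a i)) (trans (ℕ.+-assoc a (a * i) b) (ℕ.+-comm a (a * i + b)))
  open Progression a (λ i → a * i + b) c-suc
  open ≋-Reasoning
  c₀≡b : a * 0 + b ≡ b
  c₀≡b = cong (_+ b) (ℕ.*-zeroʳ a)
  identity₁ : ∑[0‥ n ] (λ i → sgn i • ((a * i + b ∷ []) ⊛ replicate (n ∸ i) a))
              ≋ (b ∷ []) ш replicate n a
  identity₁ = begin
    ∑[0‥ n ] (λ i → sgn i • stuffleFamily [] i (n ∸ i))  ≈⟨ ∑-alternatingSum n (stuffleFamily []) ⟩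
    alternatingSum (stuffleFamily []) n                   ≈⟨ alternatingSum≋single-ш n ⟩
    (a * 0 + b ∷ []) ш replicate n a                      ≡⟨ cong (λ x → (x ∷ []) ш replicate n a) c₀≡b ⟩
    (b ∷ []) ш replicate n a                              ∎
  identity₂ : ∑[0‥ n ] (λ i → ∑[0‥ n ∸ i ] (λ j →
             sgn (i + j) • ((a * i + b ∷ a * j + b ∷ []) ⊛ replicate (n ∸ i ∸ j) a)))
           ≋ (b ∷ b ∷ []) ш replicate n a
  identity₂ = begin
    ∑[0‥ n ] (λ i → ∑[0‥ n ∸ i ] (λ j → sgn (i + j) • stuffleFamily (a * i + b ∷ []) j (n ∸ i ∸ j)))
      ≈⟨ ∑∑-alternatingSum n (λ i → stuffleFamily (a * i + b ∷ [])) ⟩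
    alternatingSum (λ i → alternatingSum (stuffleFamily (a * i + b ∷ []))) n
      ≈⟨ alternatingSum²≋double-ш n ⟩
    (a * 0 + b ∷ a * 0 + b ∷ []) ш replicate n a
      ≡⟨ cong (λ x → (x ∷ x ∷ []) ш replicate n a) c₀≡b ⟩
    (b ∷ b ∷ []) ш replicate n a ∎
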